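{- Let $k\ge 2$ and $d\ge (k+2)^2$ be integers. Then $K(d,k)>2(d-1)k$.
   Context: Let $I(d)$ denote the graph of the $d$-dimensional hypercube. For an integer $k\ge 1$, a $(d,k)$ circuit code is a simple cycle $C$ in $I(d)$ such that $d_{I(d)}(x,y)\ge \min\{d_C(x,y),k\}$ for all vertices $x,y$ of $C$, where $d_{I(d)}$ is the Hamming distance and $d_C$ is the graph distance along $C$. $K(d,k)$ denotes the maximum length of a $(d,k)$ circuit code. -}

module Defs where

open import Data.Bool using (Bool; true; false)
open import Data.Nat using (ℕ; zero; suc; _+_; _∸_; _≤_; _⊓_; ∣_-_∣)
open import Data.Fin using (Fin; toℕ)
open import Data.Vec using (Vec; []; _∷_)
open import Relation.Binary.PropositionalEquality using (_≡_)
open import Function.Definitions using (Injective)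

Vertex : ℕ → Set
Vertex d = Vec Bool d

-- Hamming distance (= graph distance in I(d))
hamming : ∀ {d} → Vertex d → Vertex d → ℕ
hamming [] [] = 0
hamming (false ∷ xs) (false ∷ ys) = hamming xs ys
hamming (true  ∷ xs) (true  ∷ ys) = hamming xs ys
hamming (false ∷ xs) (true  ∷ ys) = suc (hamming xs ys)
hamming (true  ∷ xs) (false ∷ ys) = suc (hamming xs ys)

cycDist : ℕ → ℕ → ℕ → ℕ
cycDist n a b = ∣ a - b ∣ ⊓ (n ∸ ∣ a - b ∣)

-- A (d,k) circuit code of length n: a simple cycle v_0 v_1 … v_{n-1} v_0 in I(d)
-- with d_{I(d)}(x,y) ≥ min{d_C(x,y), k} for all vertices x,y of the cycle.
record CircuitCode (d k n : ℕ) : Set where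
  field
    vtx     : Fin n → Vertex d
    length≥3 : 3 ≤ n
    simple  : Injective _≡_ _≡_ vtx
    edges   : ∀ i j → cycDist n (toℕ i) (toℕ j) ≡ 1 → hamming (vtx i) (vtx j) ≡ 1
    spread  : ∀ i j → cycDist n (toℕ i) (toℕ j) ⊓ k ≤ hamming (vtx i) (vtx j)

module Submission where

-- Write d = 2p + r (r ≤ 1) and M = 2p.  The "snake" is the standard cycle of
-- length M in I(p); its Hamming distances are exactly the distances along that
-- cycle.  Taking two snake blocks gives an isometric copy of the torus
-- Z_M × Z_M (with the ℓ¹ metric) inside I(2p) ⊆ I(d).  The code is the closed
-- walk i ↦ (X i mod M, Y i mod M), 0 ≤ i < n, along a staircase with
-- X i + Y i = i that winds k + 1 times around the first and k times around the
-- second factor, so n = (2k + 1)M > 2(d - 1)k.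

open import Data.Bool using (Bool; true; false; not; _xor_; if_then_else_)
open import Data.Bool.Properties using (xor-identityʳ; xor-comm; not-distribˡ-xor; not-distribʳ-xor; not-involutive)
open import Data.Empty using (⊥; ⊥-elim)
open import Data.Fin using (Fin; toℕ)
open import Data.Fin.Properties using (toℕ<n; toℕ-injective)
open import Data.Nat
open import Data.Nat.DivMod
open import Data.Nat.Properties
open import Algebra.Properties.CommutativeSemigroup +-commutativeSemigroup
  using () renaming (interchange to +-interchange)
open import Data.Nat.Tactic.RingSolver using (solve-∀)
open import Data.Product using (∃; ∃-syntax; _,_; proj₁; proj₂; _×_)
open import Data.Sum using (_⊎_; inj₁; inj₂)
open import Data.Vec using ([]; _∷_)
open import Relation.Binary.Definitions using (tri<; tri≈; tri>)
open import Relation.Binary.PropositionalEquality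
open import Relation.Nullary using (yes; no)
open import Defs

≤-witness : ∀ {a b} → a ≤ b → ∃ λ x → b ≡ a + x
≤-witness h = let (x , eq) = m≤n⇒∃[o]m+o≡n h in x , sym eq

<-witness : ∀ {a b} → a < b → ∃ λ x → b ≡ suc (a + x)
<-witness (s≤s h) = let (x , eq) = ≤-witness h in x , cong suc eq

≤-from-witness : ∀ {a b} x → b ≡ a + x → a ≤ b
≤-from-witness {a} x refl = m≤m+n a x

<-from-witness : ∀ {a b} x → b ≡ suc (a + x) → a < b
<-from-witness {a} x refl = s≤s (m≤m+n a x)

∸-from-witness : ∀ {a b c} → a ≡ b + c → a ∸ b ≡ c
∸-from-witness {b = b} {c} refl = m+n∸m≡n b c

cycDist-comm : ∀ m a b → cycDist m a b ≡ cycDist m b a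
cycDist-comm m a b rewrite ∣-∣-comm a b = refl

indicator : Bool → ℕ
indicator true  = 1
indicator false = 0

count : ℕ → (ℕ → Bool) → ℕ
count zero    f = 0
count (suc m) f = indicator (f 0) + count m (λ c → f (suc c))

count-cong : ∀ m {f g : ℕ → Bool} → (∀ c → c < m → f c ≡ g c) → count m f ≡ count m g
count-cong zero    h = refl
count-cong (suc m) h =
  cong₂ _+_ (cong indicator (h 0 z<s)) (count-cong m (λ c c<m → h (suc c) (s≤s c<m)))

count-false : ∀ m → count m (λ _ → false) ≡ 0
count-false zero    = refl
count-false (suc m) = count-false m

count-complement : ∀ m (f : ℕ → Bool) → count m (λ c → not (f c)) ≡ m ∸ count m f
count-complement m f = sym (trans (cong (_∸ count m f) (sym (sum m f)))
                                  (m+n∸n≡m (count m (λ c → not (f c))) (count m f)))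
  where
    sum : ∀ m (f : ℕ → Bool) → count m (λ c → not (f c)) + count m f ≡ m
    sum zero    f = refl
    sum (suc m) f with f 0
    ... | true  = trans (+-suc _ _) (cong suc (sum m (λ c → f (suc c))))
    ... | false = cong suc (sum m (λ c → f (suc c)))

count-+ : ∀ a b (f : ℕ → Bool) → count (a + b) f ≡ count a f + count b (λ c → f (a + c))
count-+ zero    b f = refl
count-+ (suc a) b f = trans (cong (indicator (f 0) +_) (count-+ a b (λ c → f (suc c))))
                            (sym (+-assoc (indicator (f 0)) _ _))

<ᵇ-true : ∀ {c a} → c < a → (c <ᵇ a) ≡ true
<ᵇ-true {zero}  {suc a} h       = refl
<ᵇ-true {suc c} {suc a} (s≤s h) = <ᵇ-true h

<ᵇ-false : ∀ {c a} → a ≤ c → (c <ᵇ a) ≡ false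
<ᵇ-false {c}     {zero}  h       = refl
<ᵇ-false {suc c} {suc a} (s≤s h) = <ᵇ-false h

<ᵇ-shiftˡ : ∀ p c a → (p + c <ᵇ p + a) ≡ (c <ᵇ a)
<ᵇ-shiftˡ zero    c a = refl
<ᵇ-shiftˡ (suc p) c a = <ᵇ-shiftˡ p c a

<ᵇ-shiftʳ : ∀ p c a → (c + p <ᵇ a + p) ≡ (c <ᵇ a)
<ᵇ-shiftʳ p c a rewrite +-comm c p | +-comm a p = <ᵇ-shiftˡ p c a

count-below : ∀ m a → a ≤ m → count m (λ c → c <ᵇ a) ≡ a
count-below zero    .zero z≤n     = refl
count-below (suc m) zero    h       = count-false m
count-below (suc m) (suc a) (s≤s h) = cong suc (count-below m a h)

count-below-xor : ∀ m a b → a ≤ m → b ≤ m →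
                  count m (λ c → (c <ᵇ a) xor (c <ᵇ b)) ≡ ∣ a - b ∣
count-below-xor zero    .zero .zero z≤n z≤n = refl
count-below-xor (suc m) zero    zero    ha       hb       = count-false m
count-below-xor (suc m) zero    (suc b) ha       (s≤s hb) = cong suc (count-below m b hb)
count-below-xor (suc m) (suc a) zero    (s≤s ha) hb       =
  cong suc (trans (count-cong m (λ c _ → xor-identityʳ (c <ᵇ a))) (count-below m a ha))
count-below-xor (suc m) (suc a) (suc b) (s≤s ha) (s≤s hb) = count-below-xor m a b ha hb

-- The snake: the standard 2p-cycle in I(p).  Its α-th vertex (α < 2p) has
-- bit c equal to [c < α] xor [c + p < α]: bits are switched on one by one,
-- then switched off again in the same order.

module Snake (p : ℕ) where

  snakeBit : ℕ → ℕ → Bool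
  snakeBit α c = (c <ᵇ α) xor (c + p <ᵇ α)

  snakeDist : ℕ → ℕ → ℕ
  snakeDist α β = count p (λ c → snakeBit α c xor snakeBit β c)

  cycDist-within : ∀ u → u ≤ p → u ⊓ (p + p ∸ u) ≡ u
  cycDist-within u h = m≤n⇒m⊓n≡m (≤-trans h (subst (p ≤_) (sym (+-∸-assoc p h)) (m≤m+n p (p ∸ u))))

  cycDist-beyond : ∀ x → x ≤ p → (x + p) ⊓ (p + p ∸ (x + p)) ≡ p ∸ x
  cycDist-beyond x h = begin
    (x + p) ⊓ (p + p ∸ (x + p)) ≡⟨ cong ((x + p) ⊓_) (cong (p + p ∸_) (+-comm x p)) ⟩
    (x + p) ⊓ (p + p ∸ (p + x)) ≡⟨ cong ((x + p) ⊓_) (sym (∸-+-assoc (p + p) p x)) ⟩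
    (x + p) ⊓ (p + p ∸ p ∸ x)   ≡⟨ cong (λ z → (x + p) ⊓ (z ∸ x)) (m+n∸m≡n p p) ⟩
    (x + p) ⊓ (p ∸ x)           ≡⟨ m≥n⇒m⊓n≡n (≤-trans (m∸n≤m p x) (m≤n+m p x)) ⟩
    p ∸ x                       ∎
    where open ≡-Reasoning

  cycDist-opposite : ∀ {α β} → α ≤ p → β ≤ p → cycDist (p + p) α (β + p) ≡ p ∸ ∣ α - β ∣
  cycDist-opposite {α} {β} hα hβ with ≤-total α β
  ... | inj₁ α≤β with ≤-witness α≤β
  ...   | x , refl = begin
    cycDist (p + p) α (α + x + p)      ≡⟨ cong (λ z → z ⊓ (p + p ∸ z)) ∣α-α+x+p∣ ⟩
    (x + p) ⊓ (p + p ∸ (x + p))        ≡⟨ cycDist-beyond x (≤-trans (m≤n+m x α) hβ) ⟩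
    p ∸ x                              ≡⟨ cong (p ∸_) (sym ∣α-α+x∣) ⟩
    p ∸ ∣ α - α + x ∣                  ∎
    where
      open ≡-Reasoning
      ∣α-α+x∣ : ∣ α - α + x ∣ ≡ x
      ∣α-α+x∣ = trans (m≤n⇒∣m-n∣≡n∸m (m≤m+n α x)) (m+n∸m≡n α x)
      ∣α-α+x+p∣ : ∣ α - α + x + p ∣ ≡ x + p
      ∣α-α+x+p∣ = trans (cong (λ z → ∣ z - α + x + p ∣) (sym (+-identityʳ α)))
                        (trans (cong (λ z → ∣ α + 0 - z ∣) (+-assoc α x p)) (∣m+n-m+o∣≡∣n-o∣ α 0 (x + p)))
  cycDist-opposite {α} {β} hα hβ | inj₂ β≤α with ≤-witness β≤α
  ...   | y , refl = begin
    cycDist (p + p) (β + y) (β + p)    ≡⟨ cong (λ z → z ⊓ (p + p ∸ z)) ∣β+y-β+p∣ ⟩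
    (p ∸ y) ⊓ (p + p ∸ (p ∸ y))        ≡⟨ cycDist-within (p ∸ y) (m∸n≤m p y) ⟩
    p ∸ y                              ≡⟨ cong (p ∸_) (sym ∣β+y-β∣) ⟩
    p ∸ ∣ β + y - β ∣                  ∎
    where
      open ≡-Reasoning
      ∣β+y-β+p∣ : ∣ β + y - β + p ∣ ≡ p ∸ y
      ∣β+y-β+p∣ = trans (∣m+n-m+o∣≡∣n-o∣ β y p) (m≤n⇒∣m-n∣≡n∸m (≤-trans (m≤n+m y β) hα))
      ∣β+y-β∣ : ∣ β + y - β ∣ ≡ y
      ∣β+y-β∣ = trans (∣-∣-comm (β + y) β) (trans (m≤n⇒∣m-n∣≡n∸m (m≤m+n β y)) (m+n∸m≡n β y))

  snakeBit-low : ∀ {α c} → α ≤ p → snakeBit α c ≡ (c <ᵇ α)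
  snakeBit-low {α} {c} h =
    trans (cong ((c <ᵇ α) xor_) (<ᵇ-false (≤-trans h (m≤n+m p c)))) (xor-identityʳ _)

  snakeBit-high : ∀ {α c} → c < p → snakeBit (α + p) c ≡ not (c <ᵇ α)
  snakeBit-high {α} {c} h rewrite <ᵇ-true {c} {α + p} (≤-trans h (m≤n+m p α)) =
    cong not (<ᵇ-shiftʳ p c α)

  snakeDist-low-low : ∀ {α β} → α ≤ p → β ≤ p → snakeDist α β ≡ ∣ α - β ∣
  snakeDist-low-low {α} {β} hα hβ =
    trans (count-cong p (λ c _ → cong₂ _xor_ (snakeBit-low hα) (snakeBit-low hβ)))
          (count-below-xor p α β hα hβ)

  snakeDist-high-high : ∀ {α β} → α ≤ p → β ≤ p → snakeDist (α + p) (β + p) ≡ ∣ α - β ∣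
  snakeDist-high-high {α} {β} hα hβ =
    trans (count-cong p (λ c c<p → trans (cong₂ _xor_ (snakeBit-high {α} c<p) (snakeBit-high {β} c<p))
                                         (not-xor-not (c <ᵇ α) (c <ᵇ β))))
          (count-below-xor p α β hα hβ)
    where
      not-xor-not : ∀ x y → (not x xor not y) ≡ (x xor y)
      not-xor-not x y = trans (sym (not-distribˡ-xor x (not y)))
                              (trans (cong not (sym (not-distribʳ-xor x y))) (not-involutive _))

  snakeDist-low-high : ∀ {α β} → α ≤ p → β ≤ p → snakeDist α (β + p) ≡ p ∸ ∣ α - β ∣
  snakeDist-low-high {α} {β} hα hβ =
    trans (count-cong p (λ c c<p → trans (cong₂ _xor_ (snakeBit-low hα) (snakeBit-high {β} c<p))
                                         (sym (not-distribʳ-xor (c <ᵇ α) (c <ᵇ β)))))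
          (trans (count-complement p (λ c → (c <ᵇ α) xor (c <ᵇ β)))
                 (cong (p ∸_) (count-below-xor p α β hα hβ)))

  snakeDist-comm : ∀ α β → snakeDist α β ≡ snakeDist β α
  snakeDist-comm α β = count-cong p (λ c _ → xor-comm (snakeBit α c) (snakeBit β c))

  ∣-∣≤ : ∀ {a b} → a ≤ p → b ≤ p → ∣ a - b ∣ ≤ p
  ∣-∣≤ {a} {b} ha hb = ≤-trans (∣m-n∣≤m⊔n a b) (⊔-lub ha hb)

  second-half : ∀ {x} → p + x < p + p → x ≤ p
  second-half {x} h = <⇒≤ (+-cancelˡ-< p x p h)

  snakeDist≡cycDist : ∀ {α β} → α < p + p → β < p + p → snakeDist α β ≡ cycDist (p + p) α β
  snakeDist≡cycDist {α} {β} hα hβ with ≤-total α p | ≤-total β p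
  ... | inj₁ α≤p | inj₁ β≤p =
    trans (snakeDist-low-low α≤p β≤p) (sym (cycDist-within _ (∣-∣≤ α≤p β≤p)))
  ... | inj₂ p≤α | inj₂ p≤β with ≤-witness p≤α | ≤-witness p≤β
  ...   | α' , refl | β' , refl =
    trans (cong₂ snakeDist (+-comm p α') (+-comm p β'))
      (trans (snakeDist-high-high (second-half hα) (second-half hβ))
        (trans (sym (cycDist-within _ (∣-∣≤ (second-half hα) (second-half hβ))))
               (cong (λ z → z ⊓ (p + p ∸ z)) (sym (∣m+n-m+o∣≡∣n-o∣ p α' β')))))
  snakeDist≡cycDist {α} {β} hα hβ | inj₁ α≤p | inj₂ p≤β with ≤-witness p≤β
  ... | β' , refl =
    trans (cong (snakeDist α) (+-comm p β'))
      (trans (snakeDist-low-high α≤p (second-half hβ))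
        (trans (sym (cycDist-opposite α≤p (second-half hβ))) (cong (cycDist (p + p) α) (+-comm β' p))))
  snakeDist≡cycDist {α} {β} hα hβ | inj₂ p≤α | inj₁ β≤p with ≤-witness p≤α
  ... | α' , refl =
    trans (snakeDist-comm (p + α') β)
      (trans (cong (snakeDist β) (+-comm p α'))
        (trans (snakeDist-low-high β≤p (second-half hα))
          (trans (sym (cycDist-opposite β≤p (second-half hα)))
            (trans (cycDist-comm (p + p) β (α' + p)) (cong (λ z → cycDist (p + p) z β) (+-comm α' p))))))

word : (d : ℕ) → (ℕ → Bool) → Vertex d
word zero    f = []
word (suc d) f = f 0 ∷ word d (λ c → f (suc c))

hamming-word : ∀ d f g → hamming (word d f) (word d g) ≡ count d (λ c → f c xor g c)
hamming-word zero    f g = refl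
hamming-word (suc d) f g with f 0 | g 0
... | true  | true  = hamming-word d _ _
... | true  | false = cong suc (hamming-word d _ _)
... | false | true  = cong suc (hamming-word d _ _)
... | false | false = hamming-word d _ _

hamming-self : ∀ {d} (v : Vertex d) → hamming v v ≡ 0
hamming-self []          = refl
hamming-self (true  ∷ v) = hamming-self v
hamming-self (false ∷ v) = hamming-self v

hamming-comm : ∀ {d} (x y : Vertex d) → hamming x y ≡ hamming y x
hamming-comm []          []          = refl
hamming-comm (true  ∷ x) (true  ∷ y) = hamming-comm x y
hamming-comm (true  ∷ x) (false ∷ y) = cong suc (hamming-comm x y)
hamming-comm (false ∷ x) (true  ∷ y) = cong suc (hamming-comm x y)
hamming-comm (false ∷ x) (false ∷ y) = hamming-comm x y

module SnakePair (p : ℕ) where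
  open Snake p

  pairBit : ℕ → ℕ → ℕ → Bool
  pairBit α β c = if c <ᵇ p then snakeBit α c else (if c <ᵇ p + p then snakeBit β (c ∸ p) else false)

  snakePair : (r : ℕ) → ℕ → ℕ → Vertex (p + p + r)
  snakePair r α β = word (p + p + r) (pairBit α β)

  hamming-snakePair : ∀ r α β α' β' →
    hamming (snakePair r α β) (snakePair r α' β') ≡ snakeDist α α' + snakeDist β β'
  hamming-snakePair r α β α' β' = begin
    hamming (snakePair r α β) (snakePair r α' β')
      ≡⟨ hamming-word (p + p + r) (pairBit α β) (pairBit α' β') ⟩
    count (p + p + r) F
      ≡⟨ cong (λ m → count m F) (+-assoc p p r) ⟩
    count (p + (p + r)) F
      ≡⟨ count-+ p (p + r) F ⟩
    count p F + count (p + r) (λ c → F (p + c))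
      ≡⟨ cong (count p F +_) (count-+ p r (λ c → F (p + c))) ⟩
    count p F + (count p (λ c → F (p + c)) + count r (λ c → F (p + (p + c))))
      ≡⟨ cong₂ _+_ first (cong₂ _+_ second padding) ⟩
    snakeDist α α' + (snakeDist β β' + 0)
      ≡⟨ cong (snakeDist α α' +_) (+-identityʳ _) ⟩
    snakeDist α α' + snakeDist β β' ∎
    where
      open ≡-Reasoning
      F : ℕ → Bool
      F c = pairBit α β c xor pairBit α' β' c
      first : count p F ≡ snakeDist α α'
      first = count-cong p pointwise
        where
          pointwise : ∀ c → c < p → F c ≡ (snakeBit α c xor snakeBit α' c)
          pointwise c c<p rewrite <ᵇ-true c<p = refl
      second : count p (λ c → F (p + c)) ≡ snakeDist β β'
      second = count-cong p pointwise
        where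
          pointwise : ∀ c → c < p → F (p + c) ≡ (snakeBit β c xor snakeBit β' c)
          pointwise c c<p rewrite <ᵇ-false {p + c} {p} (m≤m+n p c) | <ᵇ-shiftˡ p c p
                                | <ᵇ-true c<p | m+n∸m≡n p c = refl
      padding : count r (λ c → F (p + (p + c))) ≡ 0
      padding = trans (count-cong r (λ c _ → pointwise c)) (count-false r)
        where
          pointwise : ∀ c → F (p + (p + c)) ≡ false
          pointwise c rewrite <ᵇ-false {p + (p + c)} {p} (m≤m+n p (p + c))
                            | <ᵇ-false {p + (p + c)} {p + p} (≤-trans (m≤m+n (p + p) c) (≤-reflexive (+-assoc p p c))) = refl

≤-⊓+⊓ : ∀ {t} x y z w → t ≤ x + z → t ≤ x + w → t ≤ y + z → t ≤ y + w → t ≤ x ⊓ y + z ⊓ w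
≤-⊓+⊓ x y z w h₁ h₂ h₃ h₄ with ⊓-sel x y | ⊓-sel z w
... | inj₁ e₁ | inj₁ e₂ rewrite e₁ | e₂ = h₁
... | inj₁ e₁ | inj₂ e₂ rewrite e₁ | e₂ = h₂
... | inj₂ e₁ | inj₁ e₂ rewrite e₁ | e₂ = h₃
... | inj₂ e₁ | inj₂ e₂ rewrite e₁ | e₂ = h₄

module Cyclic (p₀ : ℕ) where
  p : ℕ
  p = suc p₀

  M : ℕ
  M = p + p

  arc : ℕ → ℕ
  arc r = r ⊓ (M ∸ r)

  cyclic : ℕ → ℕ
  cyclic z = arc (z % M)

  arc-of : ∀ r x → M ≡ r + x → arc r ≡ r ⊓ x
  arc-of r x M≡ = cong (r ⊓_) (∸-from-witness {M} {r} {x} M≡)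

  arc-triangle-direct : ∀ a b g → M ≡ suc (a + b + g) → arc b ≤ arc (a + b) + arc a
  arc-triangle-direct a b g M≡ = begin
    arc b                               ≡⟨ arc-of b (suc (a + g)) M≡b ⟩
    b ⊓ suc (a + g)                     ≤⟨ ≤-⊓+⊓ (a + b) (suc g) a (b + suc g) h₁ h₂ h₃ h₄ ⟩
    (a + b) ⊓ suc g + a ⊓ (b + suc g)   ≡⟨ sym (cong₂ _+_ (arc-of (a + b) (suc g) M≡a+b) (arc-of a (b + suc g) M≡a)) ⟩
    arc (a + b) + arc a                 ∎
    where
      open ≤-Reasoning
      regroup : ∀ a b g → suc (a + b + g) ≡ b + suc (a + g)
      regroup = solve-∀
      M≡b : M ≡ b + suc (a + g)
      M≡b = trans M≡ (regroup a b g)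
      M≡a+b : M ≡ a + b + suc g
      M≡a+b = trans M≡ (sym (+-suc (a + b) g))
      M≡a : M ≡ a + (b + suc g)
      M≡a = trans M≡a+b (+-assoc a b (suc g))
      t≤b : b ⊓ suc (a + g) ≤ b
      t≤b = m⊓n≤m b (suc (a + g))
      h₁ : b ⊓ suc (a + g) ≤ a + b + a
      h₁ = ≤-trans t≤b (≤-trans (m≤n+m b a) (m≤m+n (a + b) a))
      h₂ : b ⊓ suc (a + g) ≤ a + b + (b + suc g)
      h₂ = ≤-trans t≤b (≤-trans (m≤n+m b a) (m≤m+n (a + b) (b + suc g)))
      h₃ : b ⊓ suc (a + g) ≤ suc g + a
      h₃ = ≤-trans (m⊓n≤n b (suc (a + g))) (≤-reflexive (cong suc (+-comm a g)))
      h₄ : b ⊓ suc (a + g) ≤ suc g + (b + suc g)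
      h₄ = ≤-trans t≤b (≤-trans (m≤m+n b (suc g)) (m≤n+m (b + suc g) (suc g)))

  arc-triangle-wrap : ∀ a b w u v → a + b ≡ M + w → M ≡ a + suc u → M ≡ b + suc v →
                      arc b ≤ arc w + arc a
  arc-triangle-wrap a b w u v a+b≡ M≡a M≡b = begin
    arc b                               ≡⟨ arc-of b (suc v) M≡b ⟩
    b ⊓ suc v                           ≤⟨ ≤-⊓+⊓ w (suc u + suc v) a (suc u) h₁ h₂ h₃ h₄ ⟩
    w ⊓ (suc u + suc v) + a ⊓ suc u     ≡⟨ sym (cong₂ _+_ (arc-of w (suc u + suc v) M≡w) (arc-of a (suc u) M≡a)) ⟩
    arc w + arc a                       ∎
    where
      open ≤-Reasoning
      regroup : ∀ u v w → suc u + w + suc v ≡ w + (suc u + suc v)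
      regroup = solve-∀
      b≡ : b ≡ suc u + w
      b≡ = +-cancelˡ-≡ a _ _ (trans a+b≡ (trans (cong (_+ w) M≡a) (+-assoc a (suc u) w)))
      a≡ : a ≡ suc v + w
      a≡ = +-cancelʳ-≡ b _ _ (trans a+b≡ (trans (cong (_+ w) M≡b) (trans (+-assoc b (suc v) w) (+-comm b _))))
      M≡w : M ≡ w + (suc u + suc v)
      M≡w = trans M≡b (trans (cong (_+ suc v) b≡) (regroup u v w))
      t≤v : b ⊓ suc v ≤ suc v
      t≤v = m⊓n≤n b (suc v)
      h₁ : b ⊓ suc v ≤ w + a
      h₁ = ≤-trans t≤v (subst (λ z → suc v ≤ w + z) (sym a≡) (≤-trans (m≤m+n (suc v) w) (m≤n+m (suc v + w) w)))
      h₂ : b ⊓ suc v ≤ w + suc u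
      h₂ = ≤-trans (m⊓n≤m b (suc v)) (≤-reflexive (trans b≡ (+-comm (suc u) w)))
      h₃ : b ⊓ suc v ≤ suc u + suc v + a
      h₃ = ≤-trans t≤v (≤-trans (m≤n+m (suc v) (suc u)) (m≤m+n (suc u + suc v) a))
      h₄ : b ⊓ suc v ≤ suc u + suc v + suc u
      h₄ = ≤-trans t≤v (≤-trans (m≤n+m (suc v) (suc u)) (m≤m+n (suc u + suc v) (suc u)))

  sum-residue : ∀ a b → a < M → b < M → a + b < M ⊎ (∃ λ w → a + b ≡ M + w × w < M × (a + b) % M ≡ w)
  sum-residue a b a<M b<M with a + b <? M
  ... | yes lt = inj₁ lt
  ... | no nlt = inj₂ (w , w≡ , w<M , trans (cong (_% M) (trans w≡ (+-comm M w)))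
                                           (trans ([m+n]%n≡m%n w M) (m<n⇒m%n≡m w<M)))
    where
      w = proj₁ (≤-witness (≮⇒≥ nlt))
      w≡ : a + b ≡ M + w
      w≡ = proj₂ (≤-witness (≮⇒≥ nlt))
      w<M : w < M
      w<M = +-cancelˡ-< M w M (subst (_< M + M) w≡ (+-mono-< a<M b<M))

  arc-triangle : ∀ a b → a < M → b < M → arc b ≤ arc ((a + b) % M) + arc a
  arc-triangle a b a<M b<M with sum-residue a b a<M b<M
  ... | inj₁ lt = subst (λ s → arc b ≤ arc s + arc a) (sym (m<n⇒m%n≡m lt))
                        (arc-triangle-direct a b (proj₁ (<-witness lt)) (proj₂ (<-witness lt)))
  ... | inj₂ (w , w≡ , _ , mod≡) =
    subst (λ s → arc b ≤ arc s + arc a) (sym mod≡)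
      (arc-triangle-wrap a b w (proj₁ (<-witness a<M)) (proj₁ (<-witness b<M)) w≡
        (trans (proj₂ (<-witness a<M)) (sym (+-suc a _))) (trans (proj₂ (<-witness b<M)) (sym (+-suc b _))))

  %M-distrib : ∀ u z → (u + z) % M ≡ (u % M + z % M) % M
  %M-distrib u z = %-distribˡ-+ u z M

  cyclic-triangle : ∀ y δ → cyclic δ ≤ cyclic (y + δ) + cyclic y
  cyclic-triangle y δ = subst (λ s → arc (δ % M) ≤ arc s + arc (y % M)) (sym (%M-distrib y δ))
                              (arc-triangle (y % M) (δ % M) (m%n<n y M) (m%n<n δ M))

  cyclic-below : ∀ {z} → z < M → cyclic z ≡ arc z
  cyclic-below h = cong arc (m<n⇒m%n≡m h)

  cyclic-small : ∀ {z} → z ≤ p → cyclic z ≡ z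
  cyclic-small {z} h = trans (cyclic-below (≤-trans (s≤s h) (m<m+n p (s≤s z≤n))))
                             (m≤n⇒m⊓n≡m (≤-trans h (subst (p ≤_) (sym (+-∸-assoc p h)) (m≤m+n p (p ∸ z)))))

  cyclic-large : ∀ {k z} → k ≤ z → k + z ≤ M → z < M → k ≤ cyclic z
  cyclic-large {k} {z} k≤z k+z≤M z<M rewrite cyclic-below z<M =
    ⊓-glb k≤z (subst (_≤ M ∸ z) (m+n∸n≡m k z) (∸-monoˡ-≤ z k+z≤M))

  cycDist-displacement : ∀ u z → cycDist M (u % M) ((u + z) % M) ≡ cyclic z
  cycDist-displacement u z rewrite %M-distrib u z
    with sum-residue (u % M) (z % M) (m%n<n u M) (m%n<n z M)
  ... | inj₁ lt rewrite m<n⇒m%n≡m lt =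
    cong arc (trans (m≤n⇒∣m-n∣≡n∸m (m≤m+n (u % M) (z % M))) (m+n∸m≡n (u % M) (z % M)))
  ... | inj₂ (w , w≡ , _ , mod≡) rewrite mod≡ = goal
    where
      α = u % M
      r = z % M
      t = proj₁ (<-witness (m%n<n z M))
      M≡ : M ≡ suc (r + t)
      M≡ = proj₂ (<-witness (m%n<n z M))
      shuffle : ∀ a b c → suc (a + b) + c ≡ suc b + c + a
      shuffle = solve-∀
      α≡ : α ≡ suc t + w
      α≡ = +-cancelʳ-≡ r α (suc t + w) (trans w≡ (trans (cong (_+ w) M≡) (shuffle r t w)))
      ∣α-w∣ : ∣ α - w ∣ ≡ suc t
      ∣α-w∣ = trans (cong (λ x → ∣ x - w ∣) α≡)
                    (trans (m≤n⇒∣n-m∣≡n∸m (m≤n+m w (suc t))) (m+n∸n≡m (suc t) w))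
      goal : arc ∣ α - w ∣ ≡ arc r
      goal rewrite ∣α-w∣ | ∸-from-witness {M} {suc t} {r} (trans M≡ (cong suc (+-comm r t)))
                 | ∸-from-witness {M} {r} {suc t} (trans M≡ (sym (+-suc r t))) = ⊓-comm (suc t) r

  cycDist-wrapped : ∀ u v z m → u + m * M ≡ v + z → cycDist M (u % M) (v % M) ≡ cyclic z
  cycDist-wrapped u v z m u+mM≡ = begin
    cycDist M (u % M) (v % M)            ≡⟨ cycDist-comm M (u % M) (v % M) ⟩
    cycDist M (v % M) (u % M)            ≡⟨ cong (cycDist M (v % M)) (sym ([m+kn]%n≡m%n u m M)) ⟩
    cycDist M (v % M) ((u + m * M) % M)  ≡⟨ cong (λ w → cycDist M (v % M) (w % M)) u+mM≡ ⟩
    cycDist M (v % M) ((v + z) % M)      ≡⟨ cycDist-displacement v z ⟩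
    cyclic z                             ∎
    where open ≡-Reasoning

-- One unit of the staircase with capacity cc.  At local time t it has made
-- unitY cc t = min(⌊t/2⌋, cc) steps in the second coordinate and
-- unitD cc t = t - 2·unitY cc t surplus steps in the first one: the two
-- coordinates alternate until the second one is full, then the first runs alone.

⌊1+n/2⌋≤1+⌊n/2⌋ : ∀ n → ⌊ suc n /2⌋ ≤ suc ⌊ n /2⌋
⌊1+n/2⌋≤1+⌊n/2⌋ zero          = z≤n
⌊1+n/2⌋≤1+⌊n/2⌋ (suc zero)    = s≤s z≤n
⌊1+n/2⌋≤1+⌊n/2⌋ (suc (suc n)) = s≤s (⌊1+n/2⌋≤1+⌊n/2⌋ n)

⌊n/2⌋+⌊n/2⌋≤n : ∀ t → ⌊ t /2⌋ + ⌊ t /2⌋ ≤ t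
⌊n/2⌋+⌊n/2⌋≤n t = subst (⌊ t /2⌋ + ⌊ t /2⌋ ≤_) (⌊n/2⌋+⌈n/2⌉≡n t) (+-monoʳ-≤ ⌊ t /2⌋ (⌊n/2⌋≤⌈n/2⌉ t))

n≤1+⌊n/2⌋+⌊n/2⌋ : ∀ t → t ≤ suc (⌊ t /2⌋ + ⌊ t /2⌋)
n≤1+⌊n/2⌋+⌊n/2⌋ t = subst₂ _≤_ (⌊n/2⌋+⌈n/2⌉≡n t) (+-suc ⌊ t /2⌋ ⌊ t /2⌋)
                      (+-monoʳ-≤ ⌊ t /2⌋ (⌊1+n/2⌋≤1+⌊n/2⌋ t))

⌊m+n/2⌋≤⌊m/2⌋+n : ∀ t x → ⌊ t + x /2⌋ ≤ ⌊ t /2⌋ + x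
⌊m+n/2⌋≤⌊m/2⌋+n t zero    rewrite +-identityʳ t | +-identityʳ ⌊ t /2⌋ = ≤-refl
⌊m+n/2⌋≤⌊m/2⌋+n t (suc x) rewrite +-suc t x | +-suc ⌊ t /2⌋ x =
  ≤-trans (⌊1+n/2⌋≤1+⌊n/2⌋ (t + x)) (s≤s (⌊m+n/2⌋≤⌊m/2⌋+n t x))

unitY : ℕ → ℕ → ℕ
unitY cc t = ⌊ t /2⌋ ⊓ cc

unitD : ℕ → ℕ → ℕ
unitD cc t = t ∸ (unitY cc t + unitY cc t)

unitX : ℕ → ℕ → ℕ
unitX cc t = unitY cc t + unitD cc t

unit-sum : ∀ cc t → unitY cc t + unitY cc t + unitD cc t ≡ t
unit-sum cc t = m+[n∸m]≡n (≤-trans (+-mono-≤ (m⊓n≤m ⌊ t /2⌋ cc) (m⊓n≤m ⌊ t /2⌋ cc)) (⌊n/2⌋+⌊n/2⌋≤n t))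

unitX+unitY : ∀ cc t → unitX cc t + unitY cc t ≡ t
unitX+unitY cc t = trans (rearrange (unitY cc t) (unitD cc t)) (unit-sum cc t)
  where
    rearrange : ∀ a b → a + b + a ≡ a + a + b
    rearrange = solve-∀

unitY≤cap : ∀ cc t → unitY cc t ≤ cc
unitY≤cap cc t = m⊓n≤n _ cc

unitY-full : ∀ cc t → cc + cc ≤ t → unitY cc t ≡ cc
unitY-full cc t h = m≥n⇒m⊓n≡n (subst (_≤ ⌊ t /2⌋) (sym (n≡⌊n+n/2⌋ cc)) (⌊n/2⌋-mono h))

unitD-balanced : ∀ cc t → t ≤ cc + cc → unitD cc t ≤ 1
unitD-balanced cc t h
  rewrite m≤n⇒m⊓n≡m (subst (⌊ t /2⌋ ≤_) (sym (n≡⌊n+n/2⌋ cc)) (⌊n/2⌋-mono h)) =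
  m≤n+o⇒m∸n≤o t (⌊ t /2⌋ + ⌊ t /2⌋) (subst (t ≤_) (sym (+-comm _ 1)) (n≤1+⌊n/2⌋+⌊n/2⌋ t))

unitD≤ : ∀ cc ee t → t ≤ cc + cc + ee → 1 ≤ ee → unitD cc t ≤ ee
unitD≤ cc ee t h₁ h₂ with ≤-total t (cc + cc)
... | inj₁ t≤ = ≤-trans (unitD-balanced cc t t≤) h₂
... | inj₂ ≤t rewrite unitY-full cc t ≤t = m≤n+o⇒m∸n≤o t (cc + cc) h₁

unitD≥2⇒full : ∀ cc t → 2 ≤ unitD cc t → unitY cc t ≡ cc
unitD≥2⇒full cc t h with ≤-total t (cc + cc)
... | inj₁ t≤ = ⊥-elim (<-irrefl refl (≤-trans h (unitD-balanced cc t t≤)))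
... | inj₂ ≤t = unitY-full cc t ≤t

unitY-mono : ∀ cc {t u} → t ≤ u → unitY cc t ≤ unitY cc u
unitY-mono cc h = ⊓-monoˡ-≤ cc (⌊n/2⌋-mono h)

unitY-lipschitz : ∀ cc t x → unitY cc (t + x) ≤ unitY cc t + x
unitY-lipschitz cc t x with ≤-total ⌊ t /2⌋ cc
... | inj₁ ≤cc rewrite m≤n⇒m⊓n≡m ≤cc = ≤-trans (m⊓n≤m _ cc) (⌊m+n/2⌋≤⌊m/2⌋+n t x)
... | inj₂ cc≤ rewrite m≥n⇒m⊓n≡n cc≤ = ≤-trans (m⊓n≤n _ cc) (m≤m+n cc x)

-- The first coordinate is monotone too: it is t minus a 1-Lipschitz function.
unitX-mono : ∀ cc t x → unitX cc t ≤ unitX cc (t + x)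
unitX-mono cc t x = +-cancelʳ-≤ (unitY cc t) _ _ (+-cancelʳ-≤ x _ _ shifted)
  where
    shifted : unitX cc t + unitY cc t + x ≤ unitX cc (t + x) + unitY cc t + x
    shifted = begin
      unitX cc t + unitY cc t + x             ≡⟨ cong (_+ x) (unitX+unitY cc t) ⟩
      t + x                                   ≡⟨ sym (unitX+unitY cc (t + x)) ⟩
      unitX cc (t + x) + unitY cc (t + x)     ≤⟨ +-monoʳ-≤ (unitX cc (t + x)) (unitY-lipschitz cc t x) ⟩
      unitX cc (t + x) + (unitY cc t + x)     ≡⟨ sym (+-assoc (unitX cc (t + x)) (unitY cc t) x) ⟩
      unitX cc (t + x) + unitY cc t + x       ∎
      where open ≤-Reasoning

-- With e = k + 3 and M = 2p = (k+1)e + s, the walk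
-- i ↦ (X i, Y i), 0 ≤ i ≤ n, consists of k units of length ℓ = 2c + e
-- (capacity c = ke + s, surplus e) followed by a last unit of length M + c'
-- (capacity c' = ke, surplus e + s).  Its key features: X i + Y i = i, both
-- coordinates are monotone, and D i = X i - Y i grows by about e per unit.

module Staircase (p₀ k s : ℕ) (2≤k : 2 ≤ k) (M≡ : suc p₀ + suc p₀ ≡ suc k * (k + 3) + s) where
  open Cyclic p₀ public

  e c' c ℓ n : ℕ
  e  = k + 3
  c' = k * e
  c  = c' + s
  ℓ  = M + c
  n  = k * ℓ + (M + c')

  M≡c+e : M ≡ c + e
  M≡c+e = trans M≡ (ring k s)
    where ring : ∀ k s → suc k * (k + 3) + s ≡ (k * (k + 3) + s) + (k + 3)
          ring = solve-∀

  ℓ≡ : ℓ ≡ c + c + e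
  ℓ≡ = trans (cong (_+ c) M≡c+e) (ring c e)
    where ring : ∀ c e → c + e + c ≡ c + c + e
          ring = solve-∀

  last≡ : M + c' ≡ c' + c' + (e + s)
  last≡ = trans (cong (_+ c') M≡c+e) (ring c' s e)
    where ring : ∀ c' s e → c' + s + e + c' ≡ c' + c' + (e + s)
          ring = solve-∀

  M≡ke+e+s : M ≡ k * e + (e + s)
  M≡ke+e+s = trans M≡c+e (ring c' s e)
    where ring : ∀ c' s e → c' + s + e ≡ c' + (e + s)
          ring = solve-∀

  unitY₀ : Bool → ℕ → ℕ
  unitY₀ true  i = (i / ℓ) * c + unitY c (i % ℓ)
  unitY₀ false i = k * c + unitY c' (i ∸ k * ℓ)

  unitD₀ : Bool → ℕ → ℕ
  unitD₀ true  i = (i / ℓ) * e + unitD c (i % ℓ)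
  unitD₀ false i = k * e + unitD c' (i ∸ k * ℓ)

  Y D X : ℕ → ℕ
  Y i = unitY₀ (i <ᵇ k * ℓ) i
  D i = unitD₀ (i <ᵇ k * ℓ) i
  X i = Y i + D i

  data Position (i : ℕ) : Set where
    inUnit : ∀ a t → a < k → t < ℓ → i ≡ a * ℓ + t →
             Y i ≡ a * c + unitY c t → D i ≡ a * e + unitD c t → Position i
    inLast : ∀ t → i ≡ k * ℓ + t →
             Y i ≡ k * c + unitY c' t → D i ≡ k * e + unitD c' t → Position i

  position : ∀ i → Position i
  position i with i <? k * ℓ
  ... | yes lt = inUnit (i / ℓ) (i % ℓ) (m<n*o⇒m/o<n lt) (m%n<n i ℓ)
                   (trans (m≡m%n+[m/n]*n i ℓ) (+-comm (i % ℓ) ((i / ℓ) * ℓ)))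
                   (cong (λ b → unitY₀ b i) (<ᵇ-true lt)) (cong (λ b → unitD₀ b i) (<ᵇ-true lt))
  ... | no nlt = inLast (i ∸ k * ℓ) (sym (m+[n∸m]≡n (≮⇒≥ nlt)))
                   (cong (λ b → unitY₀ b i) (<ᵇ-false (≮⇒≥ nlt))) (cong (λ b → unitD₀ b i) (<ᵇ-false (≮⇒≥ nlt)))

  ae+e≤ke : ∀ {a} → a < k → a * e + e ≤ k * e
  ae+e≤ke {a} h = subst (_≤ k * e) (+-comm e (a * e)) (*-monoˡ-≤ e h)

  ke≤M : k * e ≤ M
  ke≤M = subst (k * e ≤_) (sym M≡ke+e+s) (m≤m+n (k * e) (e + s))

  1≤e : 1 ≤ e
  1≤e = ≤-trans (s≤s z≤n) (m≤n+m 3 k)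

  k<e : k < e
  k<e = m<m+n k (s≤s z≤n)

  unitD-in-unit : ∀ {t} → t < ℓ → unitD c t ≤ e
  unitD-in-unit {t} t<ℓ = unitD≤ c e t (subst (t ≤_) ℓ≡ (<⇒≤ t<ℓ)) 1≤e

  record UnitBounds (i : ℕ) : Set where
    field
      unit       : ℕ
      unit≤k     : unit ≤ k
      start≤i    : unit * ℓ ≤ i
      i<end      : unit < k → i < unit * ℓ + ℓ
      Y≥         : unit * c ≤ Y i
      Y≤         : Y i ≤ unit * c + c
      D≥         : unit * e ≤ D i
      D≤         : unit < k → D i ≤ unit * e + e
      D≤M        : D i ≤ M
      full-unit  : unit < k → unit * e + 2 ≤ D i → Y i ≡ unit * c + c
      full-last  : unit ≡ k → k * e + 2 ≤ D i → Y i ≡ k * c + c'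

  unitBounds : ∀ i → i ≤ n → UnitBounds i
  unitBounds i i≤n with position i
  ... | inUnit a t a<k t<ℓ i≡ Y≡ D≡ = record
    { unit      = a
    ; unit≤k    = <⇒≤ a<k
    ; start≤i   = subst (a * ℓ ≤_) (sym i≡) (m≤m+n (a * ℓ) t)
    ; i<end     = λ _ → subst (_< a * ℓ + ℓ) (sym i≡) (+-monoʳ-< (a * ℓ) t<ℓ)
    ; Y≥        = subst (a * c ≤_) (sym Y≡) (m≤m+n (a * c) _)
    ; Y≤        = subst (_≤ a * c + c) (sym Y≡) (+-monoʳ-≤ (a * c) (unitY≤cap c t))
    ; D≥        = subst (a * e ≤_) (sym D≡) (m≤m+n (a * e) _)
    ; D≤        = λ _ → D≤ae+e
    ; D≤M       = ≤-trans D≤ae+e (≤-trans (ae+e≤ke a<k) ke≤M)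
    ; full-unit = λ _ h → trans Y≡ (cong (a * c +_)
                    (unitD≥2⇒full c t (+-cancelˡ-≤ (a * e) 2 _ (subst (a * e + 2 ≤_) D≡ h))))
    ; full-last = λ a≡k _ → ⊥-elim (<-irrefl a≡k a<k)
    }
    where
      D≤ae+e : D i ≤ a * e + e
      D≤ae+e = subst (_≤ a * e + e) (sym D≡) (+-monoʳ-≤ (a * e) (unitD-in-unit t<ℓ))
  ... | inLast t i≡ Y≡ D≡ = record
    { unit      = k
    ; unit≤k    = ≤-refl
    ; start≤i   = subst (k * ℓ ≤_) (sym i≡) (m≤m+n (k * ℓ) t)
    ; i<end     = λ k<k → ⊥-elim (<-irrefl refl k<k)
    ; Y≥        = subst (k * c ≤_) (sym Y≡) (m≤m+n (k * c) _)
    ; Y≤        = subst (_≤ k * c + c) (sym Y≡) (+-monoʳ-≤ (k * c) (≤-trans (unitY≤cap c' t) (m≤m+n c' s)))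
    ; D≥        = subst (k * e ≤_) (sym D≡) (m≤m+n (k * e) _)
    ; D≤        = λ k<k → ⊥-elim (<-irrefl refl k<k)
    ; D≤M       = subst (_≤ M) (sym D≡) (subst (k * e + unitD c' t ≤_) (sym M≡ke+e+s)
                    (+-monoʳ-≤ (k * e) (unitD≤ c' (e + s) t (subst (t ≤_) last≡ t≤) (≤-trans 1≤e (m≤m+n e s)))))
    ; full-unit = λ k<k → ⊥-elim (<-irrefl refl k<k)
    ; full-last = λ _ h → trans Y≡ (cong (k * c +_)
                    (unitD≥2⇒full c' t (+-cancelˡ-≤ (k * e) 2 _ (subst (k * e + 2 ≤_) D≡ h))))
    }
    where
      t≤ : t ≤ M + c'
      t≤ = +-cancelˡ-≤ (k * ℓ) t (M + c') (subst (_≤ n) i≡ i≤n)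

  open UnitBounds

  unit-mono : ∀ {i j} (Bi : UnitBounds i) (Bj : UnitBounds j) → i ≤ j → unit Bi ≤ unit Bj
  unit-mono Bi Bj i≤j with unit Bi ≤? unit Bj
  ... | yes h = h
  ... | no h  = ⊥-elim (<-irrefl refl (≤-trans (i<end Bj uj<k) (≤-trans end≤start (≤-trans (start≤i Bi) i≤j))))
    where
      uj<ui : unit Bj < unit Bi
      uj<ui = ≰⇒> h
      uj<k : unit Bj < k
      uj<k = <-≤-trans uj<ui (unit≤k Bi)
      end≤start : unit Bj * ℓ + ℓ ≤ unit Bi * ℓ
      end≤start = subst (_≤ unit Bi * ℓ) (+-comm ℓ (unit Bj * ℓ)) (*-monoˡ-≤ ℓ uj<ui)

  c+k<M : c + suc k ≤ M
  c+k<M = subst (c + suc k ≤_) (sym M≡c+e) (+-monoʳ-≤ c (≤-from-witness 2 (+-suc k 2)))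

  -- While D advances by at most k, Y advances by at most one capacity c: if j
  -- is in a later unit than i, then unit(i) is already full and unit(j) is the next one.
  Y-gain≤c : ∀ {i j} → i ≤ j → j ≤ n → D j ≤ D i + k → Y j ≤ Y i + c
  Y-gain≤c {i} {j} i≤j j≤n D-flat = gain (unitBounds i (≤-trans i≤j j≤n)) (unitBounds j j≤n)
    where
      gain : UnitBounds i → UnitBounds j → Y j ≤ Y i + c
      gain Bi Bj with m≤n⇒m<n∨m≡n (unit-mono Bi Bj i≤j)
      ... | inj₂ a≡b = ≤-trans (Y≤ Bj) (subst (λ z → z * c + c ≤ Y i + c) a≡b (+-monoˡ-≤ c (Y≥ Bi)))
      ... | inj₁ a<b = ≤-trans (Y≤ Bj) (subst (b * c + c ≤_) (cong (_+ c) (sym Yi-full)) bc+c≤)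
        where
          a = unit Bi
          b = unit Bj
          ring₁ : ∀ x k → x + (k + 3) ≡ x + 2 + k + 1
          ring₁ = solve-∀
          ring₂ : ∀ x k → (k + 3) + ((k + 3) + x) ≡ suc (x + (k + 3) + k + 2)
          ring₂ = solve-∀
          ring₃ : ∀ x c → c + (c + x) ≡ x + c + c
          ring₃ = solve-∀
          a<k : a < k
          a<k = <-≤-trans a<b (unit≤k Bj)
          -- D j is in a later unit, so D i has two surplus steps: unit a is full
          Di≥ : a * e + 2 ≤ D i
          Di≥ = +-cancelʳ-≤ k (a * e + 2) (D i)
                  (≤-trans (≤-from-witness 1 (ring₁ (a * e) k))
                    (≤-trans (≤-trans (subst (_≤ b * e) (+-comm e (a * e)) (*-monoˡ-≤ e a<b)) (D≥ Bj)) D-flat))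
          Yi-full : Y i ≡ a * c + c
          Yi-full = full-unit Bi a<k Di≥
          -- and D j < (a + 2) e, so j lies at most one unit further
          be<2+a·e : b * e < (2 + a) * e
          be<2+a·e = ≤-<-trans (D≥ Bj) (≤-<-trans D-flat
                       (≤-<-trans (+-monoˡ-≤ k (D≤ Bi a<k)) (<-from-witness 2 (ring₂ (a * e) k))))
          b≤1+a : b ≤ suc a
          b≤1+a = s≤s⁻¹ (*-cancelʳ-< e b (2 + a) be<2+a·e)
          bc+c≤ : b * c + c ≤ a * c + c + c
          bc+c≤ = subst (_≤ a * c + c + c) (+-comm c (b * c))
                    (≤-trans (+-monoʳ-≤ c (*-monoˡ-≤ c b≤1+a)) (≤-reflexive (ring₃ (a * c) c)))

  Y-bounded-when-D-flat : ∀ i j → i ≤ j → j ≤ n → D j ≤ D i + k → Y j + suc k ≤ Y i + M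
  Y-bounded-when-D-flat i j i≤j j≤n D-flat = begin
    Y j + suc k         ≤⟨ +-monoˡ-≤ (suc k) (Y-gain≤c i≤j j≤n D-flat) ⟩
    Y i + c + suc k     ≡⟨ +-assoc (Y i) c (suc k) ⟩
    Y i + (c + suc k)   ≤⟨ +-monoʳ-≤ (Y i) c+k<M ⟩
    Y i + M             ∎
    where open ≤-Reasoning

  unit-zero : ∀ a → a * e ≤ k → a ≡ 0
  unit-zero zero    h = refl
  unit-zero (suc a) h = ⊥-elim (<-irrefl refl (<-≤-trans k<e (≤-trans (m≤m+n e (a * e)) h)))

  kc+c'≡kM : k * c + c' ≡ k * M
  kc+c'≡kM = trans (sym (*-distribˡ-+ k c e)) (cong (k *_) (sym M≡c+e))

  -- If D advances by at least M - k, then i is in the first unit and j in the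
  -- full last unit, so Y advances by at least (k - 1)M + k + 1.
  Y-wraps-when-D-wraps : ∀ i j → i ≤ j → j ≤ n → D i + M ≤ D j + k → Y i + k * M + suc k ≤ Y j + M
  Y-wraps-when-D-wraps i j i≤j j≤n D-wraps =
    subst (λ y → Y i + k * M + suc k ≤ y + M) (sym Yj≡kM)
      (≤-trans (+-monoˡ-≤ (suc k) (+-monoˡ-≤ (k * M) Yi≤c))
               (≤-trans (≤-reflexive (ring₂ c (k * M) (suc k))) (+-monoʳ-≤ (k * M) c+k<M)))
    where
      ring₁ : ∀ x k s → x + ((k + 3) + s) ≡ x + 2 + k + (1 + s)
      ring₁ = solve-∀
      ring₂ : ∀ c x y → c + x + y ≡ x + (c + y)
      ring₂ = solve-∀
      Bi = unitBounds i (≤-trans i≤j j≤n)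
      Bj = unitBounds j j≤n
      Di≤k : D i ≤ k
      Di≤k = +-cancelʳ-≤ M (D i) k (≤-trans D-wraps (subst (D j + k ≤_) (+-comm M k) (+-monoˡ-≤ k (D≤M Bj))))
      Yi≤c : Y i ≤ c
      Yi≤c = subst (λ z → Y i ≤ z * c + c) (unit-zero (unit Bi) (≤-trans (D≥ Bi) Di≤k)) (Y≤ Bi)
      M≤Dj+k : M ≤ D j + k
      M≤Dj+k = ≤-trans (m≤n+m M (D i)) D-wraps
      unit-j≡k : unit Bj ≡ k
      unit-j≡k with m≤n⇒m<n∨m≡n (unit≤k Bj)
      ... | inj₂ eq = eq
      ... | inj₁ lt = ⊥-elim (<-irrefl refl (≤-<-trans M≤Dj+k
                        (≤-<-trans (+-monoˡ-≤ k (≤-trans (D≤ Bj lt) (ae+e≤ke lt))) ke+k<M)))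
        where
          ke+k<M : k * e + k < M
          ke+k<M = subst (k * e + k <_) (sym M≡ke+e+s) (+-monoʳ-< (k * e) (<-≤-trans k<e (m≤m+n e s)))
      Dj≥ : k * e + 2 ≤ D j
      Dj≥ = +-cancelʳ-≤ k (k * e + 2) (D j)
              (≤-trans (≤-trans (≤-from-witness (1 + s) (ring₁ (k * e) k s)) (≤-reflexive (sym M≡ke+e+s))) M≤Dj+k)
      Yj≡kM : Y j ≡ k * M
      Yj≡kM = trans (full-last Bj unit-j≡k Dj≥) kc+c'≡kM

  private
    unit-sum-identity : ∀ a c e y d → a * c + y + (a * e + d) + (a * c + y) ≡ a * (c + c + e) + (y + y + d)
    unit-sum-identity = solve-∀

  X+Y≡i : ∀ i → X i + Y i ≡ i
  X+Y≡i i with position i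
  ... | inUnit a t _ _ i≡ Y≡ D≡ rewrite Y≡ | D≡ =
    trans (unit-sum-identity a c e (unitY c t) (unitD c t))
          (trans (cong₂ (λ x y → a * x + y) (sym ℓ≡) (unit-sum c t)) (sym i≡))
  ... | inLast t i≡ Y≡ D≡ rewrite Y≡ | D≡ =
    trans (unit-sum-identity k c e (unitY c' t) (unitD c' t))
          (trans (cong₂ (λ x y → k * x + y) (sym ℓ≡) (unit-sum c' t)) (sym i≡))

  unit-order : ∀ a t b u → a * ℓ + t ≤ b * ℓ + u → u < ℓ → a ≤ b
  unit-order a t b u h u<ℓ with a ≤? b
  ... | yes a≤b = a≤b
  ... | no a≰b  = ⊥-elim (<-irrefl refl (<-≤-trans (+-monoʳ-< (b * ℓ) u<ℓ)
                    (≤-trans (subst (_≤ a * ℓ) (+-comm ℓ (b * ℓ)) (*-monoˡ-≤ ℓ (≰⇒> a≰b)))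
                      (≤-trans (m≤m+n (a * ℓ) t) h))))

  Monotone : ℕ → ℕ → Set
  Monotone i j = (Y i ≤ Y j) × (X i ≤ X j)

  monotone-across-units : ∀ {i j} a b → a < b → Y i ≤ a * c + c → D i ≤ a * e + e →
                          b * c ≤ Y j → b * e ≤ D j → Monotone i j
  monotone-across-units {i} {j} a b a<b Yi≤ Di≤ Yj≥ Dj≥ =
    ≤-trans Yi≤ (≤-trans ac+c≤bc Yj≥) ,
    ≤-trans (+-mono-≤ Yi≤ Di≤) (+-mono-≤ (≤-trans ac+c≤bc Yj≥) (≤-trans ae+e≤be Dj≥))
    where
      ac+c≤bc : a * c + c ≤ b * c
      ac+c≤bc = subst (_≤ b * c) (+-comm c (a * c)) (*-monoˡ-≤ c a<b)
      ae+e≤be : a * e + e ≤ b * e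
      ae+e≤be = subst (_≤ b * e) (+-comm e (a * e)) (*-monoˡ-≤ e a<b)

  monotone-within-unit : ∀ {i j} a cc t u → t ≤ u →
                         Y i ≡ a * c + unitY cc t → D i ≡ a * e + unitD cc t →
                         Y j ≡ a * c + unitY cc u → D j ≡ a * e + unitD cc u → Monotone i j
  monotone-within-unit a cc t u t≤u Yi≡ Di≡ Yj≡ Dj≡ rewrite Yi≡ | Di≡ | Yj≡ | Dj≡ =
    +-monoʳ-≤ (a * c) (unitY-mono cc t≤u) ,
    subst₂ _≤_ (+-interchange (a * c) (a * e) (unitY cc t) (unitD cc t))
               (+-interchange (a * c) (a * e) (unitY cc u) (unitD cc u))
      (+-monoʳ-≤ (a * c + a * e) (subst (λ z → unitX cc t ≤ unitX cc z) (m+[n∸m]≡n t≤u) (unitX-mono cc t (u ∸ t))))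
    where
      interchange : ∀ x y a b → x + y + (a + b) ≡ x + a + (y + b)
      interchange = solve-∀

  walk-mono : ∀ i j → i ≤ j → Monotone i j
  walk-mono i j i≤j with position i | position j
  ... | inUnit a t a<k t<ℓ i≡ Yi≡ Di≡ | inUnit b u b<k u<ℓ j≡ Yj≡ Dj≡
    with m≤n⇒m<n∨m≡n (unit-order a t b u (subst₂ _≤_ i≡ j≡ i≤j) u<ℓ)
  ...   | inj₁ a<b = monotone-across-units a b a<b
                       (subst (_≤ a * c + c) (sym Yi≡) (+-monoʳ-≤ (a * c) (unitY≤cap c t)))
                       (subst (_≤ a * e + e) (sym Di≡) (+-monoʳ-≤ (a * e) (unitD-in-unit t<ℓ)))
                       (subst (b * c ≤_) (sym Yj≡) (m≤m+n _ _)) (subst (b * e ≤_) (sym Dj≡) (m≤m+n _ _))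
  ...   | inj₂ refl = monotone-within-unit a c t u (+-cancelˡ-≤ (a * ℓ) t u (subst₂ _≤_ i≡ j≡ i≤j)) Yi≡ Di≡ Yj≡ Dj≡
  walk-mono i j i≤j | inUnit a t a<k t<ℓ i≡ Yi≡ Di≡ | inLast u j≡ Yj≡ Dj≡ =
    monotone-across-units a k a<k
      (subst (_≤ a * c + c) (sym Yi≡) (+-monoʳ-≤ (a * c) (unitY≤cap c t)))
      (subst (_≤ a * e + e) (sym Di≡) (+-monoʳ-≤ (a * e) (unitD-in-unit t<ℓ)))
      (subst (k * c ≤_) (sym Yj≡) (m≤m+n _ _)) (subst (k * e ≤_) (sym Dj≡) (m≤m+n _ _))
  walk-mono i j i≤j | inLast t i≡ Yi≡ Di≡ | inUnit b u b<k u<ℓ j≡ Yj≡ Dj≡ =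
    ⊥-elim (<-irrefl refl (<-≤-trans b<k (unit-order k t b u (subst₂ _≤_ i≡ j≡ i≤j) u<ℓ)))
  walk-mono i j i≤j | inLast t i≡ Yi≡ Di≡ | inLast u j≡ Yj≡ Dj≡ =
    monotone-within-unit k c' t u (+-cancelˡ-≤ (k * ℓ) t u (subst₂ _≤_ i≡ j≡ i≤j)) Yi≡ Di≡ Yj≡ Dj≡

  -- The walk ends at Y n = kM, D n = M, i.e. X n = (k+1)M: a closed curve on the torus.
  walk-end : (Y n ≡ k * M) × (D n ≡ M)
  walk-end with position n
  ... | inUnit a t a<k t<ℓ n≡ _ _ =
    ⊥-elim (<-irrefl refl (<-≤-trans a<k (unit-order k (M + c') a t (≤-reflexive n≡) t<ℓ)))
  ... | inLast t n≡ Y≡ D≡ =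
    trans Y≡ (trans (cong (k * c +_) Y-full) kc+c'≡kM) ,
    trans D≡ (trans (cong (k * e +_) D-full) (sym M≡ke+e+s))
    where
      t≡ : t ≡ M + c'
      t≡ = sym (+-cancelˡ-≡ (k * ℓ) (M + c') t n≡)
      Y-full : unitY c' t ≡ c'
      Y-full = unitY-full c' t (subst (c' + c' ≤_) (sym (trans t≡ last≡)) (m≤m+n (c' + c') (e + s)))
      D-full : unitD c' t ≡ e + s
      D-full = trans (cong (t ∸_) (cong₂ _+_ Y-full Y-full))
                     (trans (cong (_∸ (c' + c')) (trans t≡ last≡)) (m+n∸m≡n (c' + c') (e + s)))

module Construction (p₀ k s r : ℕ) (2≤k : 2 ≤ k) (M≡ : suc p₀ + suc p₀ ≡ suc k * (k + 3) + s) where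
  open Staircase p₀ k s 2≤k M≡ public
  open Snake p using (snakeDist≡cycDist)
  open SnakePair p using (snakePair; hamming-snakePair)

  dim : ℕ
  dim = p + p + r

  V : ℕ → Vertex dim
  V i = snakePair r (X i % M) (Y i % M)

  hamming-V : ∀ i j → hamming (V i) (V j) ≡ cycDist M (X i % M) (X j % M) + cycDist M (Y i % M) (Y j % M)
  hamming-V i j = trans (hamming-snakePair r (X i % M) (Y i % M) (X j % M) (Y j % M))
                        (cong₂ _+_ (snakeDist≡cycDist (m%n<n (X i) M) (m%n<n (X j) M))
                                   (snakeDist≡cycDist (m%n<n (Y i) M) (m%n<n (Y j) M)))

  Y-end : Y n ≡ k * M
  Y-end = proj₁ walk-end

  X-end : X n ≡ suc k * M
  X-end = trans (cong₂ _+_ Y-end (proj₂ walk-end)) (+-comm (k * M) M)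

  n≡ : n ≡ k * M + k * M + M
  n≡ = trans (sym (X+Y≡i n)) (trans (cong₂ _+_ X-end Y-end) (ring (k * M) M))
    where ring : ∀ a m → m + a + a ≡ a + a + m
          ring = solve-∀

  -- 4k ≤ (k + 1)(k + 3) ≤ M, so that 2k ≤ p
  2k≤p : k + k ≤ p
  2k≤p = half (subst ((k + k) + (k + k) ≤_) (sym M≡)
           (≤-trans (≤-trans (≤-from-witness 3 (ring k)) (+-monoʳ-≤ (k + 3) (*-monoʳ-≤ k (m≤n+m 3 k))))
                    (m≤m+n (suc k * (k + 3)) s)))
    where
      ring : ∀ k → (k + 3) + k * 3 ≡ (k + k) + (k + k) + 3
      ring = solve-∀
      half : ∀ {a b} → a + a ≤ b + b → a ≤ b
      half {a} {b} h with a ≤? b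
      ... | yes a≤b = a≤b
      ... | no a≰b  = ⊥-elim (<-irrefl refl (<-≤-trans (+-mono-< (≰⇒> a≰b) (≰⇒> a≰b)) h))

  2k≤M : k + k ≤ M
  2k≤M = ≤-trans 2k≤p (m≤m+n p p)

  -- Increments of the walk between positions i ≤ j, forwards (from i to j)
  -- and backwards (from j around the closed walk back to i).

  ΔX ΔY ΔX' ΔY' : ℕ → ℕ → ℕ
  ΔX  i j = X j ∸ X i
  ΔY  i j = Y j ∸ Y i
  ΔX' i j = X i + suc k * M ∸ X j
  ΔY' i j = Y i + k * M ∸ Y j

  X-forward : ∀ {i j} → i ≤ j → X j ≡ X i + ΔX i j
  X-forward {i} {j} i≤j = sym (m+[n∸m]≡n (proj₂ (walk-mono i j i≤j)))

  Y-forward : ∀ {i j} → i ≤ j → Y j ≡ Y i + ΔY i j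
  Y-forward {i} {j} i≤j = sym (m+[n∸m]≡n (proj₁ (walk-mono i j i≤j)))

  X-backward : ∀ {i j} → j ≤ n → X i + suc k * M ≡ X j + ΔX' i j
  X-backward {i} {j} j≤n = sym (m+[n∸m]≡n Xj≤)
    where
      Xj≤ : X j ≤ X i + suc k * M
      Xj≤ = ≤-trans (subst (X j ≤_) X-end (proj₂ (walk-mono j n j≤n))) (m≤n+m _ (X i))

  Y-backward : ∀ {i j} → j ≤ n → Y i + k * M ≡ Y j + ΔY' i j
  Y-backward {i} {j} j≤n = sym (m+[n∸m]≡n Yj≤)
    where
      Yj≤ : Y j ≤ Y i + k * M
      Yj≤ = ≤-trans (subst (Y j ≤_) Y-end (proj₁ (walk-mono j n j≤n))) (m≤n+m _ (Y i))

  span-forward : ∀ {i j} → i ≤ j → j ∸ i ≡ ΔX i j + ΔY i j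
  span-forward {i} {j} i≤j = ∸-from-witness {j} {i} (begin
    j                               ≡⟨ sym (X+Y≡i j) ⟩
    X j + Y j                       ≡⟨ cong₂ _+_ (X-forward i≤j) (Y-forward i≤j) ⟩
    X i + ΔX i j + (Y i + ΔY i j)   ≡⟨ +-interchange (X i) (ΔX i j) (Y i) (ΔY i j) ⟩
    X i + Y i + (ΔX i j + ΔY i j)   ≡⟨ cong (_+ (ΔX i j + ΔY i j)) (X+Y≡i i) ⟩
    i + (ΔX i j + ΔY i j)           ∎)
    where open ≡-Reasoning

  span-backward : ∀ {i j} → i ≤ j → j ≤ n → n ∸ (j ∸ i) ≡ ΔX' i j + ΔY' i j
  span-backward {i} {j} i≤j j≤n = ∸-from-witness {n} {j ∸ i} (+-cancelˡ-≡ i _ _ (begin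
    i + n                                     ≡⟨ cong₂ _+_ (sym (X+Y≡i i)) (sym (X+Y≡i n)) ⟩
    X i + Y i + (X n + Y n)                   ≡⟨ cong (λ z → X i + Y i + z) (cong₂ _+_ X-end Y-end) ⟩
    X i + Y i + (suc k * M + k * M)           ≡⟨ +-interchange (X i) (Y i) (suc k * M) (k * M) ⟩
    X i + suc k * M + (Y i + k * M)           ≡⟨ cong₂ _+_ (X-backward j≤n) (Y-backward j≤n) ⟩
    X j + ΔX' i j + (Y j + ΔY' i j)           ≡⟨ +-interchange (X j) (ΔX' i j) (Y j) (ΔY' i j) ⟩
    X j + Y j + (ΔX' i j + ΔY' i j)           ≡⟨ cong (_+ (ΔX' i j + ΔY' i j)) (X+Y≡i j) ⟩
    j + (ΔX' i j + ΔY' i j)                   ≡⟨ cong (_+ (ΔX' i j + ΔY' i j)) (sym (m+[n∸m]≡n i≤j)) ⟩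
    i + (j ∸ i) + (ΔX' i j + ΔY' i j)         ≡⟨ +-assoc i (j ∸ i) _ ⟩
    i + ((j ∸ i) + (ΔX' i j + ΔY' i j))       ∎))
    where open ≡-Reasoning

  hamming-forward : ∀ {i j} → i ≤ j → hamming (V i) (V j) ≡ cyclic (ΔX i j) + cyclic (ΔY i j)
  hamming-forward {i} {j} i≤j = trans (hamming-V i j) (cong₂ _+_
    (trans (cong (λ v → cycDist M (X i % M) (v % M)) (X-forward i≤j)) (cycDist-displacement (X i) (ΔX i j)))
    (trans (cong (λ v → cycDist M (Y i % M) (v % M)) (Y-forward i≤j)) (cycDist-displacement (Y i) (ΔY i j))))

  hamming-backward : ∀ {i j} → j ≤ n → hamming (V i) (V j) ≡ cyclic (ΔX' i j) + cyclic (ΔY' i j)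
  hamming-backward {i} {j} j≤n = trans (hamming-V i j) (cong₂ _+_
    (cycDist-wrapped (X i) (X j) (ΔX' i j) (suc k) (X-backward j≤n))
    (cycDist-wrapped (Y i) (Y j) (ΔY' i j) k (Y-backward j≤n)))

  D≤i : ∀ i → D i ≤ i
  D≤i i = subst (D i ≤_) (X+Y≡i i) (≤-trans (m≤n+m (D i) (Y i)) (m≤m+n (Y i + D i) (Y i)))

  -- D grows no faster than the position, since Y is monotone.
  D-slower : ∀ {i j} → i ≤ j → i + D j ≤ j + D i
  D-slower {i} {j} i≤j = begin
    i + D j                     ≡⟨ cong (_+ D j) (sym (X+Y≡i i)) ⟩
    Y i + D i + Y i + D j       ≡⟨ regroup (Y i) (D i) (D j) ⟩
    Y i + Y i + (D i + D j)     ≤⟨ +-monoˡ-≤ (D i + D j) (+-mono-≤ Yi≤Yj Yi≤Yj) ⟩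
    Y j + Y j + (D i + D j)     ≡⟨ cong (Y j + Y j +_) (+-comm (D i) (D j)) ⟩
    Y j + Y j + (D j + D i)     ≡⟨ sym (regroup (Y j) (D j) (D i)) ⟩
    Y j + D j + Y j + D i       ≡⟨ cong (_+ D i) (X+Y≡i j) ⟩
    j + D i                     ∎
    where
      open ≤-Reasoning
      regroup : ∀ y d d' → y + d + y + d' ≡ y + y + (d + d')
      regroup = solve-∀
      Yi≤Yj : Y i ≤ Y j
      Yi≤Yj = proj₁ (walk-mono i j i≤j)

  span-room : ∀ {i j} x → i ≤ j → j ≤ n → D j ≤ D i + x → (j ∸ i) + M ≤ n + x
  span-room {i} {j} x i≤j j≤n D-step = +-cancelˡ-≤ i _ _ (begin
    i + ((j ∸ i) + M)   ≡⟨ sym (+-assoc i (j ∸ i) M) ⟩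
    i + (j ∸ i) + M     ≡⟨ cong (_+ M) (m+[n∸m]≡n i≤j) ⟩
    j + M               ≡⟨ cong (j +_) (sym (proj₂ walk-end)) ⟩
    j + D n             ≤⟨ D-slower j≤n ⟩
    n + D j             ≤⟨ +-monoʳ-≤ n (≤-trans D-step (+-monoˡ-≤ x (D≤i i))) ⟩
    n + (i + x)         ≡⟨ regroup n i x ⟩
    i + (n + x)         ∎)
    where
      open ≤-Reasoning
      regroup : ∀ n i x → n + (i + x) ≡ i + (n + x)
      regroup = solve-∀

  -- For i ≤ j ≤ n with L = j - i, the Hamming
  -- distance h of V i and V j is either ≥ k while both arcs between i and j
  -- have length ≥ k, or it equals the length of one of the two arcs.

  Separated : ℕ → ℕ → Set
  Separated h L = (k ≤ h × k ≤ L × k ≤ n ∸ L) ⊎ (h ≡ L × 2 ≤ n ∸ L) ⊎ (h ≡ n ∸ L × 2 ≤ L)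

  short-or-far : ∀ dx dy → dx ≤ dy + k → dy + suc k ≤ M →
                 (k ≤ cyclic dx + cyclic dy × k ≤ dy) ⊎ (cyclic dx + cyclic dy ≡ dx + dy)
  short-or-far dx dy dx≤ dy+k<M with k ≤? dy
  ... | yes k≤dy = inj₁ (≤-trans (cyclic-large k≤dy k+dy≤M dy<M) (m≤n+m _ _) , k≤dy)
    where
      k+dy≤M : k + dy ≤ M
      k+dy≤M = ≤-trans (≤-reflexive (+-comm k dy)) (≤-trans (+-monoʳ-≤ dy (n≤1+n k)) dy+k<M)
      dy<M : dy < M
      dy<M = <-≤-trans (m<m+n dy z<s) dy+k<M
  ... | no k≰dy = inj₂ (cong₂ _+_ (cyclic-small dx≤p) (cyclic-small dy≤p))
    where
      dy<k : dy < k
      dy<k = ≰⇒> k≰dy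
      dy≤p : dy ≤ p
      dy≤p = ≤-trans (<⇒≤ dy<k) (≤-trans (m≤m+n k k) 2k≤p)
      dx≤p : dx ≤ p
      dx≤p = ≤-trans dx≤ (≤-trans (+-monoˡ-≤ k (<⇒≤ dy<k)) 2k≤p)

  ≤-complement : ∀ {x L} → L + x ≤ n → x ≤ n ∸ L
  ≤-complement {x} {L} h = subst (_≤ n ∸ L) (m+n∸m≡n L x) (∸-monoˡ-≤ L h)

  ΔX≤ΔY+ : ∀ {i j} x → i ≤ j → D j ≤ D i + x → ΔX i j ≤ ΔY i j + x
  ΔX≤ΔY+ {i} {j} x i≤j D-step = +-cancelˡ-≤ (X i) _ _ (begin
    X i + ΔX i j               ≡⟨ sym (X-forward i≤j) ⟩
    Y j + D j                  ≤⟨ +-mono-≤ (≤-reflexive (Y-forward i≤j)) D-step ⟩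
    Y i + ΔY i j + (D i + x)   ≡⟨ +-interchange (Y i) (ΔY i j) (D i) x ⟩
    X i + (ΔY i j + x)         ∎)
    where open ≤-Reasoning

  ΔX≡ΔY+ : ∀ {i j} → i ≤ j → D i ≤ D j → ΔX i j ≡ ΔY i j + (D j ∸ D i)
  ΔX≡ΔY+ {i} {j} i≤j Di≤Dj = +-cancelˡ-≡ (X i) _ _ (begin
    X i + ΔX i j                       ≡⟨ sym (X-forward i≤j) ⟩
    Y j + D j                          ≡⟨ cong₂ _+_ (Y-forward i≤j) (sym (m+[n∸m]≡n Di≤Dj)) ⟩
    Y i + ΔY i j + (D i + (D j ∸ D i)) ≡⟨ +-interchange (Y i) (ΔY i j) (D i) (D j ∸ D i) ⟩
    X i + (ΔY i j + (D j ∸ D i))       ∎)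
    where open ≡-Reasoning

  ΔX'≤ΔY'+ : ∀ {i j} x → j ≤ n → D i + M ≤ D j + x → ΔX' i j ≤ ΔY' i j + x
  ΔX'≤ΔY'+ {i} {j} x j≤n D-step = +-cancelˡ-≤ (X j) _ _ (begin
    X j + ΔX' i j                ≡⟨ sym (X-backward j≤n) ⟩
    X i + (M + k * M)            ≡⟨ regroup (Y i) (D i) M (k * M) ⟩
    Y i + k * M + (D i + M)      ≤⟨ +-mono-≤ (≤-reflexive (Y-backward j≤n)) D-step ⟩
    Y j + ΔY' i j + (D j + x)    ≡⟨ +-interchange (Y j) (ΔY' i j) (D j) x ⟩
    X j + (ΔY' i j + x)          ∎)
    where
      open ≤-Reasoning
      regroup : ∀ y d m a → y + d + (m + a) ≡ y + a + (d + m)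
      regroup = solve-∀

  ΔY-short : ∀ {i j} → i ≤ j → j ≤ n → D j ≤ D i + k → ΔY i j + suc k ≤ M
  ΔY-short {i} {j} i≤j j≤n D-flat = +-cancelˡ-≤ (Y i) _ _
    (subst (_≤ Y i + M) (trans (cong (_+ suc k) (Y-forward i≤j)) (+-assoc (Y i) (ΔY i j) (suc k)))
           (Y-bounded-when-D-flat i j i≤j j≤n D-flat))

  ΔY'-short : ∀ {i j} → i ≤ j → j ≤ n → D i + M ≤ D j + k → ΔY' i j + suc k ≤ M
  ΔY'-short {i} {j} i≤j j≤n D-wraps = +-cancelˡ-≤ (Y j) _ _
    (subst (_≤ Y j + M) (trans (cong (_+ suc k) (Y-backward j≤n)) (+-assoc (Y j) (ΔY' i j) (suc k)))
           (Y-wraps-when-D-wraps i j i≤j j≤n D-wraps))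

  -- Case 1: D nearly constant from i to j.  Then the backward arc is long
  -- (it must make up almost a full turn of D) ...
  near-room : ∀ {i j} → i ≤ j → j ≤ n → D j ≤ D i + k → (j ∸ i) + k ≤ n
  near-room {i} {j} i≤j j≤n D-flat = +-cancelʳ-≤ k _ _ (begin
    (j ∸ i) + k + k     ≡⟨ +-assoc (j ∸ i) k k ⟩
    (j ∸ i) + (k + k)   ≤⟨ +-monoʳ-≤ (j ∸ i) 2k≤M ⟩
    (j ∸ i) + M         ≤⟨ span-room k i≤j j≤n D-flat ⟩
    n + k               ∎)
    where open ≤-Reasoning

  -- ... and the forward arc is either long or geodesic.
  separated-near : ∀ {i j} → i ≤ j → j ≤ n → D j ≤ D i + k → Separated (hamming (V i) (V j)) (j ∸ i)
  separated-near {i} {j} i≤j j≤n D-flat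
    with short-or-far (ΔX i j) (ΔY i j) (ΔX≤ΔY+ k i≤j D-flat) (ΔY-short i≤j j≤n D-flat)
  ... | inj₁ (k≤h , k≤ΔY) = inj₁ (subst (k ≤_) (sym (hamming-forward i≤j)) k≤h ,
                                  ≤-trans k≤ΔY (subst (ΔY i j ≤_) (sym (span-forward i≤j)) (m≤n+m _ _)) ,
                                  ≤-complement (near-room i≤j j≤n D-flat))
  ... | inj₂ h≡ = inj₂ (inj₁ (trans (hamming-forward i≤j) (trans h≡ (sym (span-forward i≤j))) ,
                              ≤-trans 2≤k (≤-complement (near-room i≤j j≤n D-flat))))

  -- Case 2: D advances by nearly a full turn M.  Then the forward arc is long ...
  wrap-room : ∀ {i j} → i ≤ j → D i + M ≤ D j + k → k ≤ j ∸ i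
  wrap-room {i} {j} i≤j D-wraps = +-cancelʳ-≤ k k (j ∸ i) (≤-trans 2k≤M M≤L+k)
    where
      M≤L+k : M ≤ (j ∸ i) + k
      M≤L+k = +-cancelˡ-≤ (i + D i) _ _ (begin
        i + D i + M            ≡⟨ +-assoc i (D i) M ⟩
        i + (D i + M)          ≤⟨ +-monoʳ-≤ i D-wraps ⟩
        i + (D j + k)          ≡⟨ sym (+-assoc i (D j) k) ⟩
        i + D j + k            ≤⟨ +-monoˡ-≤ k (D-slower i≤j) ⟩
        j + D i + k            ≡⟨ cong (λ z → z + D i + k) (sym (m+[n∸m]≡n i≤j)) ⟩
        i + (j ∸ i) + D i + k  ≡⟨ regroup i (j ∸ i) (D i) k ⟩
        i + D i + ((j ∸ i) + k) ∎)
        where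
          open ≤-Reasoning
          regroup : ∀ i l d k → i + l + d + k ≡ i + d + (l + k)
          regroup = solve-∀

  -- ... and the backward arc is either long or geodesic.
  separated-wrap : ∀ {i j} → i ≤ j → j ≤ n → D i + M ≤ D j + k → Separated (hamming (V i) (V j)) (j ∸ i)
  separated-wrap {i} {j} i≤j j≤n D-wraps
    with short-or-far (ΔX' i j) (ΔY' i j) (ΔX'≤ΔY'+ k j≤n D-wraps) (ΔY'-short i≤j j≤n D-wraps)
  ... | inj₁ (k≤h , k≤ΔY') = inj₁ (subst (k ≤_) (sym (hamming-backward j≤n)) k≤h ,
                                   wrap-room i≤j D-wraps ,
                                   ≤-trans k≤ΔY' (subst (ΔY' i j ≤_) (sym (span-backward i≤j j≤n)) (m≤n+m _ _)))
  ... | inj₂ h≡ = inj₂ (inj₂ (trans (hamming-backward j≤n) (trans h≡ (sym (span-backward i≤j j≤n))) ,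
                              ≤-trans 2≤k (wrap-room i≤j D-wraps)))

  -- Case 3: D advances by dD ∈ (k, M - k).  Then both arcs are long, and the
  -- Hamming distance is at least the cyclic length of dD, hence ≥ k.
  separated-middle : ∀ {i j} → i ≤ j → j ≤ n → D i + k < D j → D j + k < D i + M →
                     Separated (hamming (V i) (V j)) (j ∸ i)
  separated-middle {i} {j} i≤j j≤n D-grows D-not-wraps = inj₁ (k≤h , k≤L , ≤-complement L+k≤n)
    where
      dD = D j ∸ D i
      Di≤Dj : D i ≤ D j
      Di≤Dj = ≤-trans (m≤m+n (D i) k) (<⇒≤ D-grows)
      Dj≡ : D j ≡ D i + dD
      Dj≡ = sym (m+[n∸m]≡n Di≤Dj)
      k<dD : k < dD
      k<dD = +-cancelˡ-< (D i) k dD (subst (D i + k <_) Dj≡ D-grows)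
      dD+k<M : dD + k < M
      dD+k<M = +-cancelˡ-< (D i) (dD + k) M (subst (_< D i + M) (trans (cong (_+ k) Dj≡) (+-assoc (D i) dD k)) D-not-wraps)
      ΔX≡ : ΔX i j ≡ ΔY i j + dD
      ΔX≡ = ΔX≡ΔY+ i≤j Di≤Dj
      k≤h : k ≤ hamming (V i) (V j)
      k≤h = begin
        k                                   ≤⟨ cyclic-large (<⇒≤ k<dD) (subst (_≤ M) (+-comm dD k) (<⇒≤ dD+k<M))
                                                           (≤-<-trans (m≤m+n dD k) dD+k<M) ⟩
        cyclic dD                           ≤⟨ cyclic-triangle (ΔY i j) dD ⟩
        cyclic (ΔY i j + dD) + cyclic (ΔY i j) ≡⟨ cong (λ z → cyclic z + cyclic (ΔY i j)) (sym ΔX≡) ⟩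
        cyclic (ΔX i j) + cyclic (ΔY i j)   ≡⟨ sym (hamming-forward i≤j) ⟩
        hamming (V i) (V j)                 ∎
        where open ≤-Reasoning
      k≤L : k ≤ j ∸ i
      k≤L = begin
        k                       ≤⟨ <⇒≤ k<dD ⟩
        dD                      ≤⟨ m≤n+m dD (ΔY i j) ⟩
        ΔY i j + dD             ≡⟨ sym ΔX≡ ⟩
        ΔX i j                  ≤⟨ m≤m+n (ΔX i j) (ΔY i j) ⟩
        ΔX i j + ΔY i j         ≡⟨ sym (span-forward i≤j) ⟩
        j ∸ i                   ∎
        where open ≤-Reasoning
      L+k≤n : (j ∸ i) + k ≤ n
      L+k≤n = +-cancelʳ-≤ dD _ _ (<⇒≤ (begin-strict
        (j ∸ i) + k + dD        ≡⟨ +-assoc (j ∸ i) k dD ⟩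
        (j ∸ i) + (k + dD)      ≡⟨ cong ((j ∸ i) +_) (+-comm k dD) ⟩
        (j ∸ i) + (dD + k)      <⟨ +-monoʳ-< (j ∸ i) dD+k<M ⟩
        (j ∸ i) + M             ≤⟨ span-room dD i≤j j≤n (≤-reflexive Dj≡) ⟩
        n + dD                  ∎))
        where open ≤-Reasoning

  separated : ∀ {i j} → i ≤ j → j ≤ n → Separated (hamming (V i) (V j)) (j ∸ i)
  separated {i} {j} i≤j j≤n with D j ≤? D i + k
  ... | yes D-flat = separated-near i≤j j≤n D-flat
  ... | no D-grows with D i + M ≤? D j + k
  ...   | yes D-wraps = separated-wrap i≤j j≤n D-wraps
  ...   | no D-not-wraps = separated-middle i≤j j≤n (≰⇒> D-grows) (≰⇒> D-not-wraps)

  cycDist-ordered : ∀ {a b} → a ≤ b → cycDist n a b ≡ (b ∸ a) ⊓ (n ∸ (b ∸ a))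
  cycDist-ordered {a} {b} a≤b rewrite m≤n⇒∣m-n∣≡n∸m a≤b = refl

  spread-ordered : ∀ {a b} → a ≤ b → b ≤ n → cycDist n a b ⊓ k ≤ hamming (V a) (V b)
  spread-ordered a≤b b≤n rewrite cycDist-ordered a≤b with separated a≤b b≤n
  ... | inj₁ (k≤h , _ , _)       = ≤-trans (m⊓n≤n _ k) k≤h
  ... | inj₂ (inj₁ (h≡L , _))    = subst (_ ≤_) (sym h≡L) (≤-trans (m⊓n≤m _ k) (m⊓n≤m _ _))
  ... | inj₂ (inj₂ (h≡n-L , _))  = subst (_ ≤_) (sym h≡n-L) (≤-trans (m⊓n≤m _ k) (m⊓n≤n _ _))

  min≡1 : ∀ {x y} → x ⊓ y ≡ 1 → 2 ≤ y → x ≡ 1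
  min≡1 {x} {y} x⊓y≡1 2≤y with ⊓-sel x y
  ... | inj₁ x⊓y≡x = trans (sym x⊓y≡x) x⊓y≡1
  ... | inj₂ x⊓y≡y = ⊥-elim (<-irrefl refl (≤-trans 2≤y (≤-reflexive (trans (sym x⊓y≡y) x⊓y≡1))))

  edge-ordered : ∀ {a b} → a ≤ b → b ≤ n → cycDist n a b ≡ 1 → hamming (V a) (V b) ≡ 1
  edge-ordered a≤b b≤n d≡1 rewrite cycDist-ordered a≤b with separated a≤b b≤n
  ... | inj₁ (_ , k≤L , k≤n-L)     = ⊥-elim (<-irrefl refl (≤-trans 2≤k (≤-trans (⊓-glb k≤L k≤n-L) (≤-reflexive d≡1))))
  ... | inj₂ (inj₁ (h≡L , 2≤n-L))  = trans h≡L (min≡1 d≡1 2≤n-L)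
  ... | inj₂ (inj₂ (h≡n-L , 2≤L))  = trans h≡n-L (min≡1 (trans (⊓-comm _ _) d≡1) 2≤L)

  distinct-ordered : ∀ {a b} → a < b → b < n → hamming (V a) (V b) ≡ 0 → ⊥
  distinct-ordered {a} {b} a<b b<n h≡0 with separated (<⇒≤ a<b) (<⇒≤ b<n)
  ... | inj₁ (k≤h , _ , _)      = <⇒≢ (≤-trans (≤-trans (s≤s z≤n) 2≤k) k≤h) (sym h≡0)
  ... | inj₂ (inj₁ (h≡L , _))   = <⇒≢ (m<n⇒0<n∸m a<b) (trans (sym h≡0) h≡L)
  ... | inj₂ (inj₂ (h≡n-L , _)) = <⇒≢ (m<n⇒0<n∸m (≤-<-trans (m∸n≤m b a) b<n)) (trans (sym h≡0) h≡n-L)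

  3≤n : 3 ≤ n
  3≤n = ≤-trans (≤-trans (+-mono-≤ 2≤k (≤-trans (s≤s z≤n) 2≤k)) 2k≤M) (subst (M ≤_) (sym n≡) (m≤n+m M _))

  code : CircuitCode dim k n
  code = record
    { vtx      = λ i → V (toℕ i)
    ; length≥3 = 3≤n
    ; simple   = injective
    ; edges    = edges
    ; spread   = spread
    }
    where
      injective : ∀ {x y : Fin n} → V (toℕ x) ≡ V (toℕ y) → x ≡ y
      injective {x} {y} Vx≡Vy with <-cmp (toℕ x) (toℕ y)
      ... | tri< x<y _ _ = ⊥-elim (distinct-ordered x<y (toℕ<n y)
                             (trans (cong (hamming (V (toℕ x))) (sym Vx≡Vy)) (hamming-self (V (toℕ x)))))
      ... | tri≈ _ x≡y _ = toℕ-injective x≡y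
      ... | tri> _ _ y<x = ⊥-elim (distinct-ordered y<x (toℕ<n x)
                             (trans (cong (hamming (V (toℕ y))) Vx≡Vy) (hamming-self (V (toℕ y)))))
      edges : ∀ x y → cycDist n (toℕ x) (toℕ y) ≡ 1 → hamming (V (toℕ x)) (V (toℕ y)) ≡ 1
      edges x y d≡1 with ≤-total (toℕ x) (toℕ y)
      ... | inj₁ x≤y = edge-ordered x≤y (<⇒≤ (toℕ<n y)) d≡1
      ... | inj₂ y≤x = trans (hamming-comm (V (toℕ x)) (V (toℕ y)))
                             (edge-ordered y≤x (<⇒≤ (toℕ<n x)) (trans (cycDist-comm n (toℕ y) (toℕ x)) d≡1))
      spread : ∀ x y → cycDist n (toℕ x) (toℕ y) ⊓ k ≤ hamming (V (toℕ x)) (V (toℕ y))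
      spread x y with ≤-total (toℕ x) (toℕ y)
      ... | inj₁ x≤y = spread-ordered x≤y (<⇒≤ (toℕ<n y))
      ... | inj₂ y≤x = subst₂ _≤_ (cong (_⊓ k) (cycDist-comm n (toℕ y) (toℕ x))) (hamming-comm (V (toℕ y)) (V (toℕ x)))
                              (spread-ordered y≤x (<⇒≤ (toℕ<n x)))

record DimensionSplit (k d : ℕ) : Set where
  field
    p₀ s r : ℕ
    r≤1    : r ≤ 1
    d≡     : d ≡ suc p₀ + suc p₀ + r
    M≡     : suc p₀ + suc p₀ ≡ suc k * (k + 3) + s

-- Splitting d as 2h + r with h = ⌊d/2⌋; h ≥ 1 because d ≥ (k+2)² ≥ 2.
dimension-split : ∀ k d → (k + 2) ^ 2 ≤ d → DimensionSplit k d
dimension-split k d bound = split ⌊ d /2⌋ (⌊n/2⌋+⌊n/2⌋≤n d) (n≤1+⌊n/2⌋+⌊n/2⌋ d)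
  where
    -- (k + 2) ^ 2 unfolds to (k + 2) * ((k + 2) * 1)
    ring : ∀ k → (k + 2) * ((k + 2) * 1) ≡ suc (suc k * (k + 3))
    ring = solve-∀
    M<d : suc (suc k * (k + 3)) ≤ d
    M<d = subst (_≤ d) (ring k) bound
    split : ∀ h → h + h ≤ d → d ≤ suc (h + h) → DimensionSplit k d
    split zero _ d≤1 with ≤-trans (m≤n+m 3 k) (≤-trans (m≤m+n (k + 3) _) (s≤s⁻¹ (≤-trans M<d d≤1)))
    ... | ()
    split (suc p₀) 2h≤d d≤2h+1 = record
      { p₀  = p₀
      ; s   = suc p₀ + suc p₀ ∸ suc k * (k + 3)
      ; r   = d ∸ (suc p₀ + suc p₀)
      ; r≤1 = m≤n+o⇒m∸n≤o d (suc p₀ + suc p₀) (subst (d ≤_) (+-comm 1 _) d≤2h+1)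
      ; d≡  = sym (m+[n∸m]≡n 2h≤d)
      ; M≡  = sym (m+[n∸m]≡n (s≤s⁻¹ (≤-trans M<d d≤2h+1)))
      }

length-bound : ∀ k M r n → r ≤ 1 → 0 < M → n ≡ k * M + k * M + M → 2 * (M + r ∸ 1) * k < n
length-bound k M r n r≤1 0<M n≡ = begin-strict
  2 * (M + r ∸ 1) * k      ≤⟨ *-monoˡ-≤ k (*-monoʳ-≤ 2 d-1≤M) ⟩
  2 * M * k                ≡⟨ ring k M ⟩
  k * M + k * M            <⟨ m<m+n (k * M + k * M) 0<M ⟩
  k * M + k * M + M        ≡⟨ sym n≡ ⟩
  n                        ∎
  where
    open ≤-Reasoning
    ring : ∀ k M → 2 * M * k ≡ k * M + k * M
    ring = solve-∀
    d-1≤M : M + r ∸ 1 ≤ M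
    d-1≤M = m≤n+o⇒m∸n≤o (M + r) 1 (subst (M + r ≤_) (+-comm M 1) (+-monoʳ-≤ M r≤1))

lemma1 : ∀ (k d : ℕ) → 2 ≤ k → (k + 2) ^ 2 ≤ d →
           ∃[ n ] (2 * (d ∸ 1) * k < n × CircuitCode d k n)
lemma1 k d 2≤k bound = n , subst (λ d → 2 * (d ∸ 1) * k < n) (sym d≡) long ,
                       subst (λ d → CircuitCode d k n) (sym d≡) code
  where
    open DimensionSplit (dimension-split k d bound)
    open Construction p₀ k s r 2≤k M≡
    long : 2 * (M + r ∸ 1) * k < n
    long = length-bound k M r n r≤1 z<s n≡
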